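{- Let $(G,V_1,V_2,V_3,k)$ be an instance of $3$-Layer Crossing Minimization. Let $u\in V_1$ and $v\in V_3$, and let $Q(u,v)$ be the set of vertices $w\in V_2$ whose neighborhood in $G$ is exactly $\{u,v\}$. Suppose $|Q(u,v)|>k+1$ and let $w\in Q(u,v)$ be arbitrary. Then $G$ admits a $3$-layer drawing respecting $(V_1,V_2,V_3)$ with at most $k$ crossings if and only if $G-w$ admits a $3$-layer drawing respecting $(V_1,V_2\setminus\{w\},V_3)$ with at most $k$ crossings.
   Context: An instance of $3$-Layer Crossing Minimization is $(G,V_1,V_2,V_3,k)$ where $(V_1,V_2,V_3)$ is a partition of $V(G)$ such that every edge has one endpoint in $V_1$ and the other in $V_2$, or one endpoint in $V_2$ and the other in $V_3$, and $k$ is a non-negative integer. A $3$-layer drawing respecting $(V_1,V_2,V_3)$ is a triple $(\sigma_1,\sigma_2,\sigma_3)$ of linear orders of $V_1,V_2,V_3$; two edges $u_1v_1,u_2v_2$ with $u_1,u_2\in V_{j-1}$, $v_1,v_2\in V_j$ cross if $\sigma_{j-1}(u_1)<\sigma_{j-1}(u_2)$ and $\sigma_j(v_1)>\sigma_j(v_2)$, or vice versa; the number of crossings is the number of crossing pairs of edges. -}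

module Defs where

open import Data.Nat using (ℕ; zero; suc; _+_; _<_; _<?_; _≤_)
open import Data.Fin using (Fin; zero; suc; punchIn) renaming (_≟_ to _≟ᶠ_)
open import Data.Bool using (Bool; true; false)
open import Data.List using (List; length; filter; cartesianProduct; allFin; map; concatMap)
open import Data.Product using (_×_; _,_; Σ; ∃; proj₁; proj₂)
open import Data.Sum using (_⊎_)
open import Relation.Binary.PropositionalEquality using (_≡_)
open import Relation.Nullary using (Dec; yes; no; ¬_)
open import Relation.Nullary.Decidable using (_×-dec_)
open import Function.Definitions using (Injective)
open import Function.Bundles using (_⇔_)
open import Data.List.Membership.Propositional using (_∈_)
open import Data.List.Relation.Unary.Unique.Propositional using (Unique)
open import Data.List.Relation.Unary.All using (All)

Layer : Set
Layer = Fin 3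

L₁ L₂ L₃ : Layer
L₁ = zero
L₂ = suc zero
L₃ = suc (suc zero)

ConsecutiveLayers : Layer → Layer → Set
ConsecutiveLayers a b =
  (a ≡ L₁ × b ≡ L₂) ⊎ (a ≡ L₂ × b ≡ L₁) ⊎ (a ≡ L₂ × b ≡ L₃) ⊎ (a ≡ L₃ × b ≡ L₂)

record LayeredGraph (n : ℕ) : Set where
  field
    adj     : Fin n → Fin n → Bool
    adj-sym : ∀ x y → adj x y ≡ adj y x
    layer   : Fin n → Layer
    layered : ∀ x y → adj x y ≡ true → ConsecutiveLayers (layer x) (layer y)
open LayeredGraph public

-- G - w : delete vertex w; the remaining vertices are renumbered via punchIn w,
-- and the partition is restricted, i.e. (V₁, V₂ ∖ {w}, V₃) when w ∈ V₂.
deleteVertex : ∀ {m} → LayeredGraph (suc m) → Fin (suc m) → LayeredGraph m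
deleteVertex G w = record
  { adj     = λ x y → adj G (punchIn w x) (punchIn w y)
  ; adj-sym = λ x y → adj-sym G (punchIn w x) (punchIn w y)
  ; layer   = λ x → layer G (punchIn w x)
  ; layered = λ x y e → layered G (punchIn w x) (punchIn w y) e
  }

-- A 3-layer drawing respecting the partition: a linear order on each layer.
-- We encode the triple (σ₁,σ₂,σ₃) by one injective position map Fin n → ℕ;
-- σⱼ is its restriction to Vⱼ (every triple of linear orders arises this way,
-- and only comparisons inside a single layer are ever used).
record Drawing (n : ℕ) : Set where
  field
    pos     : Fin n → ℕ
    pos-inj : Injective _≡_ _≡_ pos
open Drawing public

module _ {n : ℕ} (G : LayeredGraph n) where

  isEdgeBetween : Layer → Layer → Fin n × Fin n → Set
  isEdgeBetween i j (a , b) = (layer G a ≡ i × layer G b ≡ j) × adj G a b ≡ true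

  isEdgeBetween? : ∀ i j (e : Fin n × Fin n) → Dec (isEdgeBetween i j e)
  isEdgeBetween? i j (a , b) =
    ((layer G a ≟ᶠ i) ×-dec (layer G b ≟ᶠ j)) ×-dec (adj G a b Data.Bool.≟ true)
    where import Data.Bool

  edgesBetween : Layer → Layer → List (Fin n × Fin n)
  edgesBetween i j = filter (isEdgeBetween? i j) (cartesianProduct (allFin n) (allFin n))

  module _ (D : Drawing n) where

    -- (u₁v₁, u₂v₂) with σ(u₁) < σ(u₂) and σ(v₁) > σ(v₂).  Each unordered crossing
    -- pair is counted exactly once as such an ordered pair.
    Crosses : (Fin n × Fin n) × (Fin n × Fin n) → Set
    Crosses ((u₁ , v₁) , (u₂ , v₂)) = pos D u₁ < pos D u₂ × pos D v₂ < pos D v₁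

    Crosses? : ∀ p → Dec (Crosses p)
    Crosses? ((u₁ , v₁) , (u₂ , v₂)) = (pos D u₁ <? pos D u₂) ×-dec (pos D v₂ <? pos D v₁)

    crossingsBetween : Layer → Layer → ℕ
    crossingsBetween i j =
      length (filter Crosses? (cartesianProduct (edgesBetween i j) (edgesBetween i j)))

    crossings : ℕ
    crossings = crossingsBetween L₁ L₂ + crossingsBetween L₂ L₃

  HasDrawingWithin : ℕ → Set
  HasDrawingWithin k = Σ (Drawing n) λ D → crossings D ≤ k

  InQ : Fin n → Fin n → Fin n → Set
  InQ u v w = layer G w ≡ L₂ × (∀ x → (adj G w x ≡ true) ⇔ (x ≡ u ⊎ x ≡ v))

  QLargerThan : Fin n → Fin n → ℕ → Set
  QLargerThan u v k =
    Σ (List (Fin n)) λ ws → Unique ws × All (InQ u v) ws × suc (suc k) ≤ length ws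

{-# OPTIONS --safe #-}
-- Deleting w restricts a drawing and cannot create crossings. Conversely, take a drawing
-- of G - w with at most k crossings. Orient the edges of both layer pairs towards V₂; then
-- each vertex q of Q(u,v) is the second endpoint of exactly one edge per pair, whose first
-- endpoint is u resp. v. A crossing pair of edges meets at most one vertex of Q(u,v), since
-- two would force both edges to start at u (or both at v). So some w' among the at least
-- k + 1 vertices of Q(u,v) ∖ {w} lies on no crossing. Inserting w just after w' makes it an
-- exact copy of w': a crossing on an edge of w would move to the parallel edge of w'.
module Submission where

open import Defs
open import Data.Bool using (true)
open import Data.Nat using (ℕ; suc; _+_; _*_; _≤_; _<_; z≤n; s≤s; s≤s⁻¹)
open import Data.Nat.Properties
  using (≤-trans; ≤-antisym; ≤∧≢⇒<; <-irrefl; <-trans; <⇒≱; n<1+n; 1+n≢n; m<1+n⇒m≤n; +-mono-≤;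
         even≢odd; *-cancelˡ-≡; *-cancelˡ-<; module ≤-Reasoning)
open import Data.Fin using (Fin; punchIn; punchOut) renaming (_≟_ to _≟ᶠ_)
open import Data.Fin.Properties
  using (punchIn-injective; punchInᵢ≢i; punchOut-cong; punchOut-injective; punchIn-punchOut; punchOut-punchIn)
open import Data.Product using (_×_; _,_; ∃; proj₁; proj₂)
open import Data.Sum using (_⊎_; inj₁; inj₂; [_,_]′)
open import Data.List using (List; []; _∷_; length; filter; cartesianProduct; allFin; _++_)
open import Data.List.Properties using (length-++; length-removeAt′)
open import Data.List.Membership.Propositional using (_∈_; _─_; find; lose)
open import Data.List.Membership.Propositional.Properties
  using (∈-filter⁺; ∈-filter⁻; ∈-cartesianProduct⁺; ∈-cartesianProduct⁻; ∈-allFin; ∈-++⁺ˡ; ∈-++⁺ʳ; ∈-++⁻)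
open import Data.List.Relation.Unary.Any using (Any; here; there; index; any?)
open import Data.List.Relation.Unary.AllPairs using (_∷_)
import Data.List.Relation.Unary.All as All
open import Data.List.Relation.Unary.All.Properties using (¬Any⇒All¬)
open import Data.List.Relation.Unary.Unique.Propositional using (Unique)
open import Data.List.Relation.Unary.Unique.Propositional.Properties using (filter⁺; cartesianProduct⁺; allFin⁺)
open import Relation.Binary.Definitions using (Decidable; DecidableEquality)
open import Relation.Binary.PropositionalEquality using (_≡_; _≢_; refl; sym; trans; cong; cong₂; subst; subst₂)
open import Relation.Nullary using (yes; no; ¬_; ¬?; contradiction)
open import Relation.Nullary.Decidable using (_⊎-dec_; decidable-stable)
open import Function using (_∘_; id)
open import Function.Definitions using (Injective)
open import Function.Bundles using (_⇔_; mk⇔; Equivalence)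

∈-─⁺ : ∀ {A : Set} {x y : A} {ys : List A} (x∈ys : x ∈ ys) → y ∈ ys → y ≢ x → y ∈ ys ─ x∈ys
∈-─⁺ (here refl)  (here refl)  y≢x = contradiction refl y≢x
∈-─⁺ (here _)     (there y∈ys) _   = y∈ys
∈-─⁺ (there _)    (here refl)  _   = here refl
∈-─⁺ (there x∈ys) (there y∈ys) y≢x = there (∈-─⁺ x∈ys y∈ys y≢x)

∈-─⁻ : ∀ {A : Set} {x y : A} {ys : List A} (x∈ys : x ∈ ys) → y ∈ ys ─ x∈ys → y ∈ ys
∈-─⁻ (here _)     y∈ys′         = there y∈ys′
∈-─⁻ (there _)    (here refl)   = here refl
∈-─⁻ (there x∈ys) (there y∈ys′) = there (∈-─⁻ x∈ys y∈ys′)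

module _ {A B : Set} {R : A → B → Set} where

  length-≤-injection : ∀ {xs ys} → Unique xs
    → (∀ {x} → x ∈ xs → ∃ λ y → y ∈ ys × R x y)
    → (∀ {x x′ y} → x ∈ xs → x′ ∈ xs → y ∈ ys → R x y → R x′ y → x ≡ x′)
    → length xs ≤ length ys
  length-≤-injection {[]}     _              _   _   = z≤n
  length-≤-injection {x ∷ xs} {ys} (x∉xs ∷ xs!) hit inj with hit (here refl)
  ... | y , y∈ys , Rxy = begin
      suc (length xs)          ≤⟨ s≤s (length-≤-injection xs! hit′ inj′) ⟩
      suc (length (ys ─ y∈ys)) ≡⟨ length-removeAt′ ys (index y∈ys) ⟨
      length ys                ∎
    where
    open ≤-Reasoning
    hit′ : ∀ {x′} → x′ ∈ xs → ∃ λ y′ → y′ ∈ ys ─ y∈ys × R x′ y′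
    hit′ x′∈xs with y′ , y′∈ys , Rx′y′ ← hit (there x′∈xs) = y′ , ∈-─⁺ y∈ys y′∈ys y′≢y , Rx′y′
      where
      y′≢y : y′ ≢ y
      y′≢y refl = All.lookup x∉xs x′∈xs (inj (here refl) (there x′∈xs) y∈ys Rxy Rx′y′)
    inj′ : ∀ {x₁ x₂ y′} → x₁ ∈ xs → x₂ ∈ xs → y′ ∈ ys ─ y∈ys → R x₁ y′ → R x₂ y′ → x₁ ≡ x₂
    inj′ x₁∈xs x₂∈xs y′∈ys′ = inj (there x₁∈xs) (there x₂∈xs) (∈-─⁻ y∈ys y′∈ys′)

  unrelated-exists : Decidable R → ∀ {xs ys} → Unique xs
    → (∀ {x x′ y} → x ∈ xs → x′ ∈ xs → y ∈ ys → R x y → R x′ y → x ≡ x′)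
    → length ys < length xs
    → ∃ λ x → x ∈ xs × ¬ Any (R x) ys
  unrelated-exists R? {xs} {ys} xs! inj ys<xs with any? (λ x → ¬? (any? (R? x) ys)) xs
  ... | yes unrelated = find unrelated
  ... | no ¬unrelated = contradiction (length-≤-injection xs! related inj) (<⇒≱ ys<xs)
    where
    related : ∀ {x} → x ∈ xs → ∃ λ y → y ∈ ys × R x y
    related {x} x∈xs =
      find (decidable-stable (any? (R? x) ys) (All.lookup (¬Any⇒All¬ xs ¬unrelated) x∈xs))

length-≤-suc-filter-≢ : ∀ {A : Set} (_≟_ : DecidableEquality A) (w : A) {xs : List A} → Unique xs
  → length xs ≤ suc (length (filter (λ x → ¬? (x ≟ w)) xs))
length-≤-suc-filter-≢ {A} _≟_ w {xs} xs! =
  length-≤-injection {R = _≡_} {ys = w ∷ others} xs! hit (λ _ _ _ x≡y x′≡y → trans x≡y (sym x′≡y))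
  where
  others : List A
  others = filter (λ x → ¬? (x ≟ w)) xs
  hit : ∀ {x} → x ∈ xs → ∃ λ y → y ∈ w ∷ others × x ≡ y
  hit {x} x∈xs with x ≟ w
  ... | yes x≡w = w , here refl , x≡w
  ... | no x≢w  = x , there (∈-filter⁺ (λ x → ¬? (x ≟ w)) x∈xs x≢w) , refl

Edge : ℕ → Set
Edge n = Fin n × Fin n

module _ {n} (G : LayeredGraph n) (D : Drawing n) (i j : Layer) where

  IsCrossingPair : Edge n × Edge n → Set
  IsCrossingPair (e , f) = isEdgeBetween G i j e × isEdgeBetween G i j f × Crosses G D (e , f)

  crossingPairs : List (Edge n × Edge n)
  crossingPairs = filter (Crosses? G D) (cartesianProduct (edgesBetween G i j) (edgesBetween G i j))

  ∈-edgesBetween⁺ : ∀ {e} → isEdgeBetween G i j e → e ∈ edgesBetween G i j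
  ∈-edgesBetween⁺ {a , b} = ∈-filter⁺ (isEdgeBetween? G i j) (∈-cartesianProduct⁺ (∈-allFin a) (∈-allFin b))

  ∈-edgesBetween⁻ : ∀ {e} → e ∈ edgesBetween G i j → isEdgeBetween G i j e
  ∈-edgesBetween⁻ = proj₂ ∘ ∈-filter⁻ (isEdgeBetween? G i j) {xs = cartesianProduct (allFin n) (allFin n)}

  ∈-crossingPairs⁺ : ∀ {p} → IsCrossingPair p → p ∈ crossingPairs
  ∈-crossingPairs⁺ (e , f , crosses) =
    ∈-filter⁺ (Crosses? G D) (∈-cartesianProduct⁺ (∈-edgesBetween⁺ e) (∈-edgesBetween⁺ f)) crosses

  ∈-crossingPairs⁻ : ∀ {p} → p ∈ crossingPairs → IsCrossingPair p
  ∈-crossingPairs⁻ p∈ with ∈p , crosses ← ∈-filter⁻ (Crosses? G D) p∈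
                       with e∈ , f∈ ← ∈-cartesianProduct⁻ (edgesBetween G i j) (edgesBetween G i j) ∈p =
    ∈-edgesBetween⁻ e∈ , ∈-edgesBetween⁻ f∈ , crosses

  crossingPairs-unique : Unique crossingPairs
  crossingPairs-unique = filter⁺ (Crosses? G D) (cartesianProduct⁺ edges! edges!)
    where
    edges! : Unique (edgesBetween G i j)
    edges! = filter⁺ (isEdgeBetween? G i j) (cartesianProduct⁺ (allFin⁺ n) (allFin⁺ n))

module _ {m n} {G : LayeredGraph m} {D : Drawing m} {i j : Layer}
               {H : LayeredGraph n} {E : Drawing n} {k l : Layer}
               (f : Edge m × Edge m → Edge n × Edge n) where

  crossingsBetween-≤-injection : Injective _≡_ _≡_ f
    → (∀ {p} → IsCrossingPair G D i j p → IsCrossingPair H E k l (f p))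
    → crossingsBetween G D i j ≤ crossingsBetween H E k l
  crossingsBetween-≤-injection f-injective f-crossing =
    length-≤-injection {R = λ p q → q ≡ f p} (crossingPairs-unique G D i j)
      (λ p∈ → f _ , ∈-crossingPairs⁺ H E k l (f-crossing (∈-crossingPairs⁻ G D i j p∈)) , refl)
      (λ _ _ _ q≡fp q≡fp′ → f-injective (trans (sym q≡fp) q≡fp′))

  crossingsBetween-≤-cover :
      (∀ {q} → IsCrossingPair H E k l q → ∃ λ p → IsCrossingPair G D i j p × q ≡ f p)
    → crossingsBetween H E k l ≤ crossingsBetween G D i j
  crossingsBetween-≤-cover cover =
    length-≤-injection {R = λ q p → q ≡ f p} (crossingPairs-unique H E k l)
      (λ q∈ → let p , crossing , q≡fp = cover (∈-crossingPairs⁻ H E k l q∈)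
              in p , ∈-crossingPairs⁺ G D i j crossing , q≡fp)
      (λ _ _ _ q≡fp q′≡fp → trans q≡fp (sym q′≡fp))

reversePair : ∀ {n} → Edge n × Edge n → Edge n × Edge n
reversePair ((a , b) , (c , d)) = (d , c) , (b , a)

reversePair-injective : ∀ {n} → Injective _≡_ _≡_ (reversePair {n})
reversePair-injective {x = (_ , _) , (_ , _)} {y = (_ , _) , (_ , _)} refl = refl

module _ {n} (G : LayeredGraph n) (D : Drawing n) where

  crossingPair-reverse : ∀ {i j p} → IsCrossingPair G D i j p → IsCrossingPair G D j i (reversePair p)
  crossingPair-reverse {p = (a , b) , (c , d)} (((la , lb) , ab) , ((lc , ld) , cd) , a<c , d<b) =
    ((ld , lc) , trans (adj-sym G d c) cd) , ((lb , la) , trans (adj-sym G b a) ab) , d<b , a<c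

  crossingsBetween-comm : ∀ i j → crossingsBetween G D i j ≡ crossingsBetween G D j i
  crossingsBetween-comm i j = ≤-antisym (reversed-≤ i j) (reversed-≤ j i)
    where
    reversed-≤ : ∀ i j → crossingsBetween G D i j ≤ crossingsBetween G D j i
    reversed-≤ i j = crossingsBetween-≤-injection {G = G} {D} {i} {j} {G} {D} {j} {i}
      reversePair reversePair-injective crossingPair-reverse

  crossings-towardsL₂ : crossings G D ≡ crossingsBetween G D L₁ L₂ + crossingsBetween G D L₃ L₂
  crossings-towardsL₂ = cong (crossingsBetween G D L₁ L₂ +_) (crossingsBetween-comm L₂ L₃)

-- Only second endpoints are inspected: pairs are always oriented towards the layer of q,
-- which for the middle layer L₂ is arranged by crossings-towardsL₂.
Meets : ∀ {n} → Fin n → Edge n × Edge n → Set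
Meets q ((_ , b) , (_ , d)) = b ≡ q ⊎ d ≡ q

Meets? : ∀ {n} → Decidable (Meets {n})
Meets? q ((_ , b) , (_ , d)) = (b ≟ᶠ q) ⊎-dec (d ≟ᶠ q)

record SoleNeighbour {n} (G : LayeredGraph n) (i j : Layer) (h q : Fin n) : Set where
  field
    layer-h : layer G h ≡ i
    layer-q : layer G q ≡ j
    adj⇔h   : ∀ x → layer G x ≡ i → adj G x q ≡ true ⇔ x ≡ h

  edge : isEdgeBetween G i j (h , q)
  edge = (layer-h , layer-q) , Equivalence.from (adj⇔h h layer-h) refl

  only-edge : ∀ {x y} → isEdgeBetween G i j (x , y) → y ≡ q → x ≡ h
  only-edge {x} ((lx , _) , xy) refl = Equivalence.to (adj⇔h x lx) xy

open SoleNeighbour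

module _ {n} {G : LayeredGraph n} {i j : Layer} {h : Fin n} where

  meets-injective : ∀ {q q′ a b c d} → SoleNeighbour G i j h q → SoleNeighbour G i j h q′
    → isEdgeBetween G i j (a , b) → isEdgeBetween G i j (c , d) → a ≢ c
    → Meets q ((a , b) , (c , d)) → Meets q′ ((a , b) , (c , d)) → q ≡ q′
  meets-injective _ _  _  _  _   (inj₁ refl) (inj₁ refl) = refl
  meets-injective S S′ ab cd a≢c (inj₁ refl) (inj₂ refl) =
    contradiction (trans (only-edge S ab refl) (sym (only-edge S′ cd refl))) a≢c
  meets-injective S S′ ab cd a≢c (inj₂ refl) (inj₁ refl) =
    contradiction (trans (only-edge S′ ab refl) (sym (only-edge S cd refl))) a≢c
  meets-injective _ _  _  _  _   (inj₂ refl) (inj₂ refl) = refl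

  module _ {D : Drawing n} {w w′ : Fin n} (S : SoleNeighbour G i j h w) (S′ : SoleNeighbour G i j h w′)
           (w-after-w′ : pos D w ≡ suc (pos D w′)) where

    private
      w′≢w : w′ ≢ w
      w′≢w refl = 1+n≢n (sym w-after-w′)

      before-w : ∀ {x} → pos D x < pos D w → x ≢ w′ → pos D x < pos D w′
      before-w {x} x<w x≢w′ = ≤∧≢⇒< (m<1+n⇒m≤n (subst (pos D x <_) w-after-w′ x<w)) (x≢w′ ∘ pos-inj D)

      after-w : ∀ {x} → pos D w < pos D x → pos D w′ < pos D x
      after-w {x} w<x = <-trans (n<1+n _) (subst (_< pos D x) w-after-w′ w<x)

    -- Moving an edge end from w to its twin w′ keeps the crossing, as no vertex lies between them.
    twin-crossingPair : ∀ {p} → IsCrossingPair G D i j p → Meets w p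
      → ∃ λ p̃ → IsCrossingPair G D i j p̃ × Meets w′ p̃ × ¬ Meets w p̃
    twin-crossingPair {(a , b) , (c , d)} (ab , cd , a<c , d<w) (inj₁ refl) =
      ((h , w′) , (c , d)) ,
      (edge S′ , cd , subst (λ x → pos D x < pos D c) a≡h a<c , before-w d<w d≢w′) ,
      inj₁ refl , λ { (inj₁ w′≡w) → w′≢w w′≡w ; (inj₂ d≡w) → <-irrefl (cong (pos D) d≡w) d<w }
      where
      a≡h : a ≡ h
      a≡h = only-edge S ab refl
      d≢w′ : d ≢ w′
      d≢w′ d≡w′ = <-irrefl (cong (pos D) (trans a≡h (sym (only-edge S′ cd d≡w′)))) a<c
    twin-crossingPair {(a , b) , (c , d)} (ab , cd , a<c , w<b) (inj₂ refl) =
      ((a , b) , (h , w′)) ,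
      (ab , edge S′ , subst (λ x → pos D a < pos D x) (only-edge S cd refl) a<c , after-w w<b) ,
      inj₂ refl , λ { (inj₁ b≡w) → <-irrefl (cong (pos D) (sym b≡w)) w<b ; (inj₂ w′≡w) → w′≢w w′≡w }

module _ {m} (w : Fin (suc m)) where

  punchInEdge : Edge m → Edge (suc m)
  punchInEdge (a , b) = punchIn w a , punchIn w b

  punchInPair : Edge m × Edge m → Edge (suc m) × Edge (suc m)
  punchInPair (e , f) = punchInEdge e , punchInEdge f

  punchInEdge-injective : Injective _≡_ _≡_ punchInEdge
  punchInEdge-injective {a , b} {a′ , b′} eq =
    cong₂ _,_ (punchIn-injective w a a′ (cong proj₁ eq)) (punchIn-injective w b b′ (cong proj₂ eq))

  punchInPair-injective : Injective _≡_ _≡_ punchInPair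
  punchInPair-injective eq =
    cong₂ _,_ (punchInEdge-injective (cong proj₁ eq)) (punchInEdge-injective (cong proj₂ eq))

  punchIn-preimage : ∀ {x} → x ≢ w → ∃ λ y → punchIn w y ≡ x
  punchIn-preimage x≢w = punchOut (x≢w ∘ sym) , punchIn-punchOut (x≢w ∘ sym)

restrictDrawing : ∀ {m} → Drawing (suc m) → Fin (suc m) → Drawing m
restrictDrawing D w = record { pos = pos D ∘ punchIn w ; pos-inj = punchIn-injective w _ _ ∘ pos-inj D }

module _ {m} (G : LayeredGraph (suc m)) (w : Fin (suc m)) where

  crossings-deleteVertex-≤ : ∀ D → crossings (deleteVertex G w) (restrictDrawing D w) ≤ crossings G D
  crossings-deleteVertex-≤ D = +-mono-≤ (deleted-≤ L₁ L₂) (deleted-≤ L₂ L₃)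
    where
    deleted-≤ : ∀ i j → crossingsBetween (deleteVertex G w) (restrictDrawing D w) i j ≤ crossingsBetween G D i j
    deleted-≤ i j =
      crossingsBetween-≤-injection {G = deleteVertex G w} {restrictDrawing D w} {i} {j} {G} {D} {i} {j}
        (punchInPair w) (punchInPair-injective w) id

  crossingPair-deleteVertex : ∀ {D D′ i j p} → layer G w ≢ i
    → (∀ {y y′} → pos D (punchIn w y) < pos D (punchIn w y′) → pos D′ y < pos D′ y′)
    → IsCrossingPair G D i j p → ¬ Meets w p
    → ∃ λ p′ → IsCrossingPair (deleteVertex G w) D′ i j p′ × p ≡ punchInPair w p′
  crossingPair-deleteVertex {p = (a , b) , (c , d)} w∉i reflects (ab , cd , a<c , d<b) ¬meets
    with a′ , refl ← punchIn-preimage w {a} (λ { refl → w∉i (proj₁ (proj₁ ab)) })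
       | b′ , refl ← punchIn-preimage w (¬meets ∘ inj₁)
       | c′ , refl ← punchIn-preimage w {c} (λ { refl → w∉i (proj₁ (proj₁ cd)) })
       | d′ , refl ← punchIn-preimage w (¬meets ∘ inj₂) =
    ((a′ , b′) , (c′ , d′)) , (ab , cd , reflects a<c , reflects d<b) , refl

module _ {m} (D′ : Drawing m) (w w′ : Fin (suc m)) (w′≢w : w′ ≢ w) where

  private
    slot-w′ : ℕ
    slot-w′ = pos D′ (punchOut (w′≢w ∘ sym))

  -- Doubling the positions of D′ leaves a free slot just after w′ for w.
  insertAfter-pos : Fin (suc m) → ℕ
  insertAfter-pos x with w ≟ᶠ x
  ... | yes _   = suc (2 * slot-w′)
  ... | no w≢x = 2 * pos D′ (punchOut w≢x)

  insertAfter-pos-≢ : ∀ {x} (w≢x : w ≢ x) → insertAfter-pos x ≡ 2 * pos D′ (punchOut w≢x)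
  insertAfter-pos-≢ {x} w≢x with w ≟ᶠ x
  ... | yes w≡x = contradiction w≡x w≢x
  ... | no _    = cong (λ y → 2 * pos D′ y) (punchOut-cong w refl)

  insertAfter-pos-injective : Injective _≡_ _≡_ insertAfter-pos
  insertAfter-pos-injective {x} {y} eq with w ≟ᶠ x | w ≟ᶠ y
  ... | yes refl | yes refl = refl
  ... | yes _    | no w≢y   = contradiction (sym eq) (even≢odd (pos D′ (punchOut w≢y)) slot-w′)
  ... | no w≢x   | yes _    = contradiction eq (even≢odd (pos D′ (punchOut w≢x)) slot-w′)
  ... | no w≢x   | no w≢y   = punchOut-injective w≢x w≢y (pos-inj D′ (*-cancelˡ-≡ _ _ 2 eq))

  insertAfter : Drawing (suc m)
  insertAfter = record { pos = insertAfter-pos ; pos-inj = insertAfter-pos-injective }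

  insertAfter-punchIn : ∀ y → pos insertAfter (punchIn w y) ≡ 2 * pos D′ y
  insertAfter-punchIn y =
    trans (insertAfter-pos-≢ (punchInᵢ≢i w y ∘ sym)) (cong (λ z → 2 * pos D′ z) (punchOut-punchIn w))

  insertAfter-reflects : ∀ {y y′} → pos insertAfter (punchIn w y) < pos insertAfter (punchIn w y′)
    → pos D′ y < pos D′ y′
  insertAfter-reflects {y} {y′} =
    *-cancelˡ-< 2 _ _ ∘ subst₂ _<_ (insertAfter-punchIn y) (insertAfter-punchIn y′)

  insertAfter-w : pos insertAfter w ≡ suc (pos insertAfter w′)
  insertAfter-w with w ≟ᶠ w
  ... | yes _   = cong suc (sym (insertAfter-pos-≢ (w′≢w ∘ sym)))
  ... | no w≢w = contradiction refl w≢w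

Uncrossed : ∀ {m} → LayeredGraph (suc m) → (w : Fin (suc m)) → Drawing m → Layer → Layer → Fin (suc m) → Set
Uncrossed G w D′ i j q = ∀ {p′} → IsCrossingPair (deleteVertex G w) D′ i j p′ → ¬ Meets q (punchInPair w p′)

lifted-meets-injective : ∀ {m} {G : LayeredGraph (suc m)} {w : Fin (suc m)} {D′ : Drawing m} {i j h q q′ p′}
  → SoleNeighbour G i j h q → SoleNeighbour G i j h q′ → IsCrossingPair (deleteVertex G w) D′ i j p′
  → Meets q (punchInPair w p′) → Meets q′ (punchInPair w p′) → q ≡ q′
lifted-meets-injective {w = w} {D′} {p′ = (a , b) , (c , d)} S S′ (ab , cd , a<c , _) =
  meets-injective S S′ ab cd (λ eq → <-irrefl (cong (pos D′) (punchIn-injective w a c eq)) a<c)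

module _ {m} (G : LayeredGraph (suc m)) (D′ : Drawing m) {i j : Layer} {h w w′ : Fin (suc m)} where

  crossingsBetween-insertAfter-≤ : (w′≢w : w′ ≢ w) → i ≢ j
    → SoleNeighbour G i j h w → SoleNeighbour G i j h w′ → Uncrossed G w D′ i j w′
    → crossingsBetween G (insertAfter D′ w w′ w′≢w) i j ≤ crossingsBetween (deleteVertex G w) D′ i j
  crossingsBetween-insertAfter-≤ w′≢w i≢j S S′ w′-uncrossed =
    crossingsBetween-≤-cover {G = deleteVertex G w} {D′} {i} {j} {G} {D} {i} {j} (punchInPair w)
      (λ crossing → deleted crossing (avoids-w crossing))
    where
    D : Drawing (suc m)
    D = insertAfter D′ w w′ w′≢w

    deleted : ∀ {p} → IsCrossingPair G D i j p → ¬ Meets w p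
      → ∃ λ p′ → IsCrossingPair (deleteVertex G w) D′ i j p′ × p ≡ punchInPair w p′
    deleted = crossingPair-deleteVertex G w {D} {D′} (λ w∈i → i≢j (trans (sym w∈i) (layer-q S)))
      (insertAfter-reflects D′ w w′ w′≢w)

    avoids-w : ∀ {p} → IsCrossingPair G D i j p → ¬ Meets w p
    avoids-w crossing meets-w
      with p̃ , crossing̃ , meets-w′ , ¬meets-w
             ← twin-crossingPair {D = D} S S′ (insertAfter-w D′ w w′ w′≢w) crossing meets-w
      with p′ , crossing′ , refl ← deleted crossing̃ ¬meets-w = w′-uncrossed crossing′ meets-w′

module _ {m} (G : LayeredGraph (suc m)) {u v : Fin (suc m)} (hu : layer G u ≡ L₁) (hv : layer G v ≡ L₃) where

  InQ-adj : ∀ {q} → InQ G u v q → ∀ x → adj G x q ≡ true ⇔ (x ≡ u ⊎ x ≡ v)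
  InQ-adj {q} (_ , N) x =
    mk⇔ (Equivalence.to (N x) ∘ trans (adj-sym G q x)) (trans (adj-sym G x q) ∘ Equivalence.from (N x))

  InQ⇒soleNeighbour₁ : ∀ {q} → InQ G u v q → SoleNeighbour G L₁ L₂ u q
  InQ⇒soleNeighbour₁ Q@(q∈L₂ , _) = record
    { layer-h = hu
    ; layer-q = q∈L₂
    ; adj⇔h   = λ x x∈L₁ → mk⇔
        ([ id , (λ { refl → contradiction (trans (sym x∈L₁) hv) λ () }) ]′ ∘ Equivalence.to (InQ-adj Q x))
        (Equivalence.from (InQ-adj Q x) ∘ inj₁)
    }

  InQ⇒soleNeighbour₃ : ∀ {q} → InQ G u v q → SoleNeighbour G L₃ L₂ v q
  InQ⇒soleNeighbour₃ Q@(q∈L₂ , _) = record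
    { layer-h = hv
    ; layer-q = q∈L₂
    ; adj⇔h   = λ x x∈L₃ → mk⇔
        ([ (λ { refl → contradiction (trans (sym x∈L₃) hu) λ () }) , id ]′ ∘ Equivalence.to (InQ-adj Q x))
        (Equivalence.from (InQ-adj Q x) ∘ inj₂)
    }

  module _ {w : Fin (suc m)} (D′ : Drawing m) where

    private
      G′ : LayeredGraph m
      G′ = deleteVertex G w

    crossings-insertAfter-≤ : ∀ {w′} → InQ G u v w → InQ G u v w′ → (w′≢w : w′ ≢ w)
      → Uncrossed G w D′ L₁ L₂ w′ → Uncrossed G w D′ L₃ L₂ w′
      → crossings G (insertAfter D′ w w′ w′≢w) ≤ crossings G′ D′
    crossings-insertAfter-≤ {w′} Qw Qw′ w′≢w uncrossed₁ uncrossed₃ = begin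
      crossings G D                                                 ≡⟨ crossings-towardsL₂ G D ⟩
      crossingsBetween G D L₁ L₂ + crossingsBetween G D L₃ L₂       ≤⟨ +-mono-≤ bound₁ bound₃ ⟩
      crossingsBetween G′ D′ L₁ L₂ + crossingsBetween G′ D′ L₃ L₂   ≡⟨ crossings-towardsL₂ G′ D′ ⟨
      crossings G′ D′                                               ∎
      where
      open ≤-Reasoning
      D : Drawing (suc m)
      D = insertAfter D′ w w′ w′≢w
      bound₁ : crossingsBetween G D L₁ L₂ ≤ crossingsBetween G′ D′ L₁ L₂
      bound₁ = crossingsBetween-insertAfter-≤ G D′ w′≢w (λ ())
                 (InQ⇒soleNeighbour₁ Qw) (InQ⇒soleNeighbour₁ Qw′) uncrossed₁
      bound₃ : crossingsBetween G D L₃ L₂ ≤ crossingsBetween G′ D′ L₃ L₂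
      bound₃ = crossingsBetween-insertAfter-≤ G D′ w′≢w (λ ())
                 (InQ⇒soleNeighbour₃ Qw) (InQ⇒soleNeighbour₃ Qw′) uncrossed₃

    UncrossedTwin : Fin (suc m) → Set
    UncrossedTwin w′ = InQ G u v w′ × w′ ≢ w × Uncrossed G w D′ L₁ L₂ w′ × Uncrossed G w D′ L₃ L₂ w′

    uncrossed-twin : ∀ {k} → QLargerThan G u v k → crossings G′ D′ ≤ k → ∃ UncrossedTwin
    uncrossed-twin {k} (ws , ws! , ws⊆Q , k+2≤ws) D′≤k =
      pick (unrelated-exists (λ q p′ → Meets? q (punchInPair w p′)) candidates! meets-once crossed<candidates)
      where
      candidates : List (Fin (suc m))
      candidates = filter (λ x → ¬? (x ≟ᶠ w)) ws

      crossed : List (Edge m × Edge m)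
      crossed = crossingPairs G′ D′ L₁ L₂ ++ crossingPairs G′ D′ L₃ L₂

      candidates! : Unique candidates
      candidates! = filter⁺ (λ x → ¬? (x ≟ᶠ w)) ws!

      candidate-InQ : ∀ {q} → q ∈ candidates → InQ G u v q
      candidate-InQ = All.lookup ws⊆Q ∘ proj₁ ∘ ∈-filter⁻ (λ x → ¬? (x ≟ᶠ w)) {xs = ws}

      meets-once : ∀ {q q′ p′} → q ∈ candidates → q′ ∈ candidates → p′ ∈ crossed
        → Meets q (punchInPair w p′) → Meets q′ (punchInPair w p′) → q ≡ q′
      meets-once q∈ q′∈ p′∈ with ∈-++⁻ (crossingPairs G′ D′ L₁ L₂) p′∈
      ... | inj₁ p′∈₁ = lifted-meets-injective {D′ = D′} (InQ⇒soleNeighbour₁ (candidate-InQ q∈))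
                          (InQ⇒soleNeighbour₁ (candidate-InQ q′∈)) (∈-crossingPairs⁻ G′ D′ L₁ L₂ p′∈₁)
      ... | inj₂ p′∈₃ = lifted-meets-injective {D′ = D′} (InQ⇒soleNeighbour₃ (candidate-InQ q∈))
                          (InQ⇒soleNeighbour₃ (candidate-InQ q′∈)) (∈-crossingPairs⁻ G′ D′ L₃ L₂ p′∈₃)

      crossed≤k : length crossed ≤ k
      crossed≤k = begin
        length crossed                                                ≡⟨ length-++ (crossingPairs G′ D′ L₁ L₂) ⟩
        crossingsBetween G′ D′ L₁ L₂ + crossingsBetween G′ D′ L₃ L₂   ≡⟨ crossings-towardsL₂ G′ D′ ⟨
        crossings G′ D′                                               ≤⟨ D′≤k ⟩
        k                                                             ∎
        where open ≤-Reasoning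

      crossed<candidates : length crossed < length candidates
      crossed<candidates =
        ≤-trans (s≤s crossed≤k) (s≤s⁻¹ (≤-trans k+2≤ws (length-≤-suc-filter-≢ _≟ᶠ_ w ws!)))

      pick : (∃ λ q → q ∈ candidates × ¬ Any (λ p′ → Meets q (punchInPair w p′)) crossed) → ∃ UncrossedTwin
      pick (w′ , w′∈ , uncrossed) =
        w′ , candidate-InQ w′∈ , proj₂ (∈-filter⁻ (λ x → ¬? (x ≟ᶠ w)) {xs = ws} w′∈) ,
        (λ crossing → uncrossed ∘ lose (∈-++⁺ˡ (∈-crossingPairs⁺ G′ D′ L₁ L₂ crossing))) ,
        (λ crossing → uncrossed ∘ lose (∈-++⁺ʳ _ (∈-crossingPairs⁺ G′ D′ L₃ L₂ crossing)))

lemma6p2 : (m : ℕ) (G : LayeredGraph (suc m)) (k : ℕ) (u v w : Fin (suc m))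
    → layer G u ≡ L₁ → layer G v ≡ L₃
    → QLargerThan G u v k
    → InQ G u v w
    → HasDrawingWithin G k ⇔ HasDrawingWithin (deleteVertex G w) k
lemma6p2 m G k u v w hu hv Q-large Qw = mk⇔ delete insert
  where
  delete : HasDrawingWithin G k → HasDrawingWithin (deleteVertex G w) k
  delete (D , D≤k) = restrictDrawing D w , ≤-trans (crossings-deleteVertex-≤ G w D) D≤k

  insert : HasDrawingWithin (deleteVertex G w) k → HasDrawingWithin G k
  insert (D′ , D′≤k) =
    let w′ , Qw′ , w′≢w , uncrossed₁ , uncrossed₃ = uncrossed-twin G hu hv D′ Q-large D′≤k
    in insertAfter D′ w w′ w′≢w ,
       ≤-trans (crossings-insertAfter-≤ G hu hv D′ Qw Qw′ w′≢w uncrossed₁ uncrossed₃) D′≤k
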